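{- For any graph $G$, $\mathrm{pw}(\triangle(G))\le\mathrm{pw}(G)+1$.
   Context: $\mathrm{pw}$ denotes pathwidth. For a graph $G$, $\triangle(G)$ is obtained from $G$ by inserting, for each edge $\{u,v\}\in E(G)$, a new vertex $x_{\{u,v\}}$ adjacent to exactly $u$ and $v$. -}

module Defs where

open import Data.Nat using (ℕ; suc; _≤_; _<_)
open import Data.Fin as Fin using (Fin; _↑ˡ_; _↑ʳ_)
open import Data.Fin.Subset using (Subset; _∈_; ∣_∣)
open import Data.Product using (_×_; _,_; Σ)
open import Data.List using (List; []; _∷_; length; lookup; _++_; map; concat; tabulate)
open import Data.List.Relation.Unary.Any using (Any)
open import Data.List.Relation.Unary.All using (All)
open import Data.List.Membership.Propositional using () renaming (_∈_ to _∈ₗ_)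
open import Relation.Binary.PropositionalEquality using (_≡_; _≢_)
open import Relation.Nullary using (¬_)

-- A finite graph on vertex set Fin n, given by its list of edges
-- (each edge {u,v} listed as an ordered pair (u , v)).
record Graph : Set where
  constructor mkGraph
  field
    n     : ℕ
    edges : List (Fin n × Fin n)
open Graph public

Simple : Graph → Set
Simple G = (∀ i → Data.Product.proj₁ (lookup (edges G) i) ≢ Data.Product.proj₂ (lookup (edges G) i))
         × (∀ i j → (lookup (edges G) i ≡ lookup (edges G) j
                     ⊎' lookup (edges G) i ≡ swap' (lookup (edges G) j)) → i ≡ j)
  where
  open import Data.Sum renaming (_⊎_ to _⊎'_)
  swap' : ∀ {A : Set} → A × A → A × A
  swap' (a , b) = (b , a)

record PathDecomposition (G : Graph) : Set where
  field
    bags        : List (Subset (n G))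
    covers-vertices : ∀ (v : Fin (n G)) → Any (v ∈_) bags
    covers-edges    : ∀ {u v} → (u , v) ∈ₗ edges G → Any (λ B → u ∈ B × v ∈ B) bags
    interpolation   : ∀ (v : Fin (n G)) (i j k : Fin (length bags)) →
                      i Fin.≤ j → j Fin.≤ k →
                      v ∈ lookup bags i → v ∈ lookup bags k → v ∈ lookup bags j
open PathDecomposition public

WidthAtMost : ∀ {G} → PathDecomposition G → ℕ → Set
WidthAtMost D k = All (λ B → ∣ B ∣ ≤ suc k) (bags D)

PwAtMost : Graph → ℕ → Set
PwAtMost G k = Σ (PathDecomposition G) λ D → WidthAtMost D k

IsPathwidth : Graph → ℕ → Set
IsPathwidth G p = PwAtMost G p × (∀ q → q < p → ¬ PwAtMost G q)

-- △(G): vertices Fin (n + m) where m = number of edges; the original vertex u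
-- is u ↑ˡ m and the new vertex x_e for the i-th edge e = {u,v} is n ↑ʳ i,
-- adjacent to exactly u and v.
triangle : Graph → Graph
triangle (mkGraph n es) = mkGraph (n Data.Nat.+ length es) (old ++ new)
  where
  m = length es
  old : List (Fin (n Data.Nat.+ m) × Fin (n Data.Nat.+ m))
  old = map (λ { (u , v) → (u ↑ˡ m , v ↑ˡ m) }) es
  new : List (Fin (n Data.Nat.+ m) × Fin (n Data.Nat.+ m))
  new = concat (tabulate λ i → let (u , v) = lookup es i in
                 ((u ↑ˡ m , n ↑ʳ i) ∷ (v ↑ˡ m , n ↑ʳ i) ∷ []))

-- Take a path decomposition of G of width p and choose, for every edge e, a bag
-- containing both ends of e.  Replace each bag B by m + 1 consecutive copies of
-- itself (m = number of edges) and add x_e to the (1 + e)-th copy of the bag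
-- chosen for e.  Every x_e then occurs in exactly one bag, next to both of its
-- neighbours, the order of the original bags is preserved, and each bag grows
-- by at most one vertex.
module Submission where

open import Defs
open import Data.Nat as ℕ using (ℕ; suc; _≤_; _+_; _*_)
open import Data.Nat.Properties using (≤-refl; +-mono-≤; +-comm; _≤?_; ≰⇒>; <⇒≱; module ≤-Reasoning)
open import Data.Bool using (true; false)
open import Data.Fin as Fin using (Fin; zero; suc; _↑ˡ_; _↑ʳ_; splitAt; combine; remQuot; cast)
open import Data.Fin.Properties using (_≟_; splitAt⁻¹-↑ˡ; splitAt⁻¹-↑ʳ; remQuot-combine; combine-remQuot; combine-monoˡ-<; toℕ-cast; cast-involutive; ≤-antisym)
open import Data.Fin.Subset using (Subset; ⊥; ⁅_⁆; ∣_∣; _∈_)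
open import Data.Fin.Subset.Properties using (∉⊥; ∣⊥∣≡0; x∈⁅x⁆; x∈⁅y⁆⇒x≡y; ∣⁅x⁆∣≡1)
open import Data.Vec as Vec using ([]; _∷_)
open import Data.Vec.Properties using (lookup-++ˡ; lookup-++ʳ; []=⇒lookup; lookup⇒[]=)
open import Data.List as List using (List; length; lookup; tabulate; map)
open import Data.List.Properties using (length-tabulate; lookup-tabulate)
open import Data.List.Relation.Unary.Any using (here; there; index)
open import Data.List.Relation.Unary.Any.Properties using (lookup-index) renaming (tabulate⁺ to Any-tabulate⁺; tabulate⁻ to Any-tabulate⁻)
open import Data.List.Relation.Unary.All as All using ()
open import Data.List.Relation.Unary.All.Properties using () renaming (tabulate⁺ to All-tabulate⁺)
open import Data.List.Membership.Propositional using () renaming (_∈_ to _∈ₗ_)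
open import Data.List.Membership.Propositional.Properties using (∈-++⁻; ∈-map⁻; ∈-concat⁻; ∈-lookup)
open import Data.Product using (_×_; _,_; proj₁; proj₂; ∃; uncurry)
open import Data.Sum using (inj₁; inj₂)
open import Relation.Nullary using (yes; no; contradiction)
open import Relation.Binary.PropositionalEquality using (_≡_; refl; sym; trans; cong; cong₂; subst; subst₂; module ≡-Reasoning)

lookup-tabulate′ : ∀ {A : Set} {k} (f : Fin k → A) (i : Fin (length (tabulate f))) →
                   lookup (tabulate f) i ≡ f (cast (length-tabulate f) i)
lookup-tabulate′ f i = begin
  lookup (tabulate f) i
    ≡⟨ cong (lookup (tabulate f)) (sym (cast-involutive (sym (length-tabulate f)) (length-tabulate f) i)) ⟩
  lookup (tabulate f) (cast (sym (length-tabulate f)) (cast (length-tabulate f) i))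
    ≡⟨ lookup-tabulate f (cast (length-tabulate f) i) ⟩
  f (cast (length-tabulate f) i) ∎
  where open ≡-Reasoning

module _ {a b} (p : Subset a) (q : Subset b) where

  ∈-++⁺ˡ : ∀ {x} → x ∈ p → x ↑ˡ b ∈ p Vec.++ q
  ∈-++⁺ˡ {x} x∈p = lookup⇒[]= (x ↑ˡ b) (p Vec.++ q) (trans (lookup-++ˡ p q x) ([]=⇒lookup x∈p))

  ∈-++⁻ˡ : ∀ {x} → x ↑ˡ b ∈ p Vec.++ q → x ∈ p
  ∈-++⁻ˡ {x} x∈p++q = lookup⇒[]= x p (trans (sym (lookup-++ˡ p q x)) ([]=⇒lookup x∈p++q))

  ∈-++⁺ʳ : ∀ {y} → y ∈ q → a ↑ʳ y ∈ p Vec.++ q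
  ∈-++⁺ʳ {y} y∈q = lookup⇒[]= (a ↑ʳ y) (p Vec.++ q) (trans (lookup-++ʳ p q y) ([]=⇒lookup y∈q))

  ∈-++⁻ʳ : ∀ {y} → a ↑ʳ y ∈ p Vec.++ q → y ∈ q
  ∈-++⁻ʳ {y} y∈p++q = lookup⇒[]= y q (trans (sym (lookup-++ʳ p q y)) ([]=⇒lookup y∈p++q))

∣p++q∣≡∣p∣+∣q∣ : ∀ {a b} (p : Subset a) (q : Subset b) → ∣ p Vec.++ q ∣ ≡ ∣ p ∣ + ∣ q ∣
∣p++q∣≡∣p∣+∣q∣ []          q = refl
∣p++q∣≡∣p∣+∣q∣ (true ∷ p)  q = cong suc (∣p++q∣≡∣p∣+∣q∣ p q)
∣p++q∣≡∣p∣+∣q∣ (false ∷ p) q = ∣p++q∣≡∣p∣+∣q∣ p q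

data SplitView (a b : ℕ) : Fin (a + b) → Set where
  left  : ∀ x → SplitView a b (x ↑ˡ b)
  right : ∀ y → SplitView a b (a ↑ʳ y)

splitView : ∀ a b (z : Fin (a + b)) → SplitView a b z
splitView a b z with splitAt a z in eq
... | inj₁ x rewrite sym (splitAt⁻¹-↑ˡ eq) = left x
... | inj₂ y rewrite sym (splitAt⁻¹-↑ʳ eq) = right y

record IndexedPathDecomposition (G : Graph) (k : ℕ) : Set where
  field
    bag           : Fin k → Subset (n G)
    vertex-in-bag : ∀ v → ∃ λ t → v ∈ bag t
    edge-in-bag   : ∀ {u v} → (u , v) ∈ₗ edges G → ∃ λ t → u ∈ bag t × v ∈ bag t
    bag-interval  : ∀ v {i j k} → i Fin.≤ j → j Fin.≤ k → v ∈ bag i → v ∈ bag k → v ∈ bag j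

module _ {G : Graph} {k : ℕ} (I : IndexedPathDecomposition G k) where
  open IndexedPathDecomposition I

  toPathDecomposition : PathDecomposition G
  toPathDecomposition = record
    { bags            = tabulate bag
    ; covers-vertices = λ v → let t , v∈ = vertex-in-bag v in Any-tabulate⁺ t v∈
    ; covers-edges    = λ uv∈ → let t , uv∈t = edge-in-bag uv∈ in Any-tabulate⁺ t uv∈t
    ; interpolation   = λ v i j k i≤j j≤k v∈i v∈k →
        subst (v ∈_) (sym (lookup-tabulate′ bag j))
          (bag-interval v (cast-mono {i} {j} i≤j) (cast-mono {j} {k} j≤k)
            (subst (v ∈_) (lookup-tabulate′ bag i) v∈i) (subst (v ∈_) (lookup-tabulate′ bag k) v∈k))
    }
    where
    cast-mono : ∀ {i j} → i Fin.≤ j → cast (length-tabulate bag) i Fin.≤ cast (length-tabulate bag) j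
    cast-mono {i} {j} = subst₂ ℕ._≤_ (sym (toℕ-cast _ i)) (sym (toℕ-cast _ j))

  toPathDecomposition-width : ∀ {w} → (∀ t → ∣ bag t ∣ ≤ suc w) → WidthAtMost toPathDecomposition w
  toPathDecomposition-width = All-tabulate⁺

data TriangleEdge {n} (es : List (Fin n × Fin n)) : (u v : Fin (n + length es)) → Set where
  old       : ∀ {a c} → (a , c) ∈ₗ es → TriangleEdge es (a ↑ˡ length es) (c ↑ˡ length es)
  attached₁ : ∀ e → TriangleEdge es (proj₁ (lookup es e) ↑ˡ length es) (n ↑ʳ e)
  attached₂ : ∀ e → TriangleEdge es (proj₂ (lookup es e) ↑ˡ length es) (n ↑ʳ e)

edges-at-subdivider : ∀ {n} (es : List (Fin n × Fin n)) → Fin (length es) →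
                      List (Fin (n + length es) × Fin (n + length es))
edges-at-subdivider {n} es e = (proj₁ (lookup es e) ↑ˡ length es , n ↑ʳ e) List.∷
                               (proj₂ (lookup es e) ↑ˡ length es , n ↑ʳ e) List.∷ List.[]

triangle-edge : ∀ {n} {es : List (Fin n × Fin n)} {u v} →
                (u , v) ∈ₗ edges (triangle (mkGraph n es)) → TriangleEdge es u v
triangle-edge {es = es} uv∈ with ∈-++⁻ (map _ es) uv∈
... | inj₁ uv∈old with ∈-map⁻ _ uv∈old
...   | _ , ac∈es , refl = old ac∈es
triangle-edge {es = es} uv∈ | inj₂ uv∈new
  with Any-tabulate⁻ (∈-concat⁻ (tabulate (edges-at-subdivider es)) uv∈new)
... | e , here refl         = attached₁ e
... | e , there (here refl) = attached₂ e

module TriangleDecomposition {n} {es : List (Fin n × Fin n)} (D : PathDecomposition (mkGraph n es)) where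
  m : ℕ
  m = length es

  L : ℕ
  L = length (bags D)

  B : Fin L → Subset n
  B = lookup (bags D)

  home : Fin m → Fin L
  home e = index (covers-edges D (∈-lookup e))

  home-contains-ends : ∀ e → proj₁ (lookup es e) ∈ B (home e) × proj₂ (lookup es e) ∈ B (home e)
  home-contains-ends e = lookup-index (covers-edges D (∈-lookup e))

  extra : Fin L → Fin (suc m) → Subset m
  extra j zero = ⊥
  extra j (suc e) with home e ≟ j
  ... | yes _ = ⁅ e ⁆
  ... | no _  = ⊥

  e∈extra-home : ∀ e → e ∈ extra (home e) (suc e)
  e∈extra-home e with home e ≟ home e
  ... | yes _   = x∈⁅x⁆ e
  ... | no ¬refl = contradiction refl ¬refl

  ∈-extra⇒home : ∀ {j s e} → e ∈ extra j s → s ≡ suc e × home e ≡ j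
  ∈-extra⇒home {j} {zero} e∈ = contradiction e∈ ∉⊥
  ∈-extra⇒home {j} {suc e′} {e} e∈ with home e′ ≟ j
  ... | yes home≡j rewrite x∈⁅y⁆⇒x≡y e′ e∈ = refl , home≡j
  ... | no _      = contradiction e∈ ∉⊥

  ∣extra∣≤1 : ∀ j s → ∣ extra j s ∣ ≤ 1
  ∣extra∣≤1 j zero rewrite ∣⊥∣≡0 m = ℕ.z≤n
  ∣extra∣≤1 j (suc e) with home e ≟ j
  ... | yes _ rewrite ∣⁅x⁆∣≡1 e = ≤-refl
  ... | no _  rewrite ∣⊥∣≡0 m   = ℕ.z≤n

  block : Fin (L * suc m) → Fin L
  block t = proj₁ (remQuot {L} (suc m) t)

  copy : Fin (L * suc m) → Fin (suc m)
  copy t = proj₂ (remQuot {L} (suc m) t)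

  bag′ : Fin L → Fin (suc m) → Subset (n + m)
  bag′ j s = B j Vec.++ extra j s

  bag : Fin (L * suc m) → Subset (n + m)
  bag t = bag′ (block t) (copy t)

  bag-combine : ∀ j s → bag (combine j s) ≡ bag′ j s
  bag-combine j s = cong (uncurry bag′) (remQuot-combine {L} {suc m} j s)

  block-mono : ∀ {t t′} → t Fin.≤ t′ → block t Fin.≤ block t′
  block-mono {t} {t′} t≤t′ with block t Fin.≤? block t′
  ... | yes b≤b′ = b≤b′
  ... | no b≰b′  = contradiction t≤t′ (<⇒≱ t′<t)
    where
    t′<t : t′ Fin.< t
    t′<t = subst₂ Fin._<_ (combine-remQuot {L} (suc m) t′) (combine-remQuot {L} (suc m) t)
             (combine-monoˡ-< (copy t′) (copy t) (≰⇒> b≰b′))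

  old∈bag : ∀ {u j} s → u ∈ B j → u ↑ˡ m ∈ bag (combine j s)
  old∈bag {u} {j} s u∈ = subst (u ↑ˡ m ∈_) (sym (bag-combine j s)) (∈-++⁺ˡ (B j) (extra j s) u∈)

  old∈bag⇒ : ∀ {u} t → u ↑ˡ m ∈ bag t → u ∈ B (block t)
  old∈bag⇒ t = ∈-++⁻ˡ (B (block t)) (extra (block t) (copy t))

  new∈home : ∀ e → n ↑ʳ e ∈ bag (combine (home e) (suc e))
  new∈home e = subst (n ↑ʳ e ∈_) (sym (bag-combine (home e) (suc e)))
                 (∈-++⁺ʳ (B (home e)) (extra (home e) (suc e)) (e∈extra-home e))

  new∈bag⇒home : ∀ {e} t → n ↑ʳ e ∈ bag t → t ≡ combine (home e) (suc e)
  new∈bag⇒home {e} t e∈t with ∈-extra⇒home (∈-++⁻ʳ (B (block t)) (extra (block t) (copy t)) e∈t)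
  ... | copy≡ , home≡ = begin
    t                                 ≡⟨ combine-remQuot {L} (suc m) t ⟨
    combine (block t) (copy t)        ≡⟨ cong₂ combine (sym home≡) copy≡ ⟩
    combine (home e) (suc e)          ∎
    where open ≡-Reasoning

  edge-in-bag : ∀ {u v} → (u , v) ∈ₗ edges (triangle (mkGraph n es)) → ∃ λ t → u ∈ bag t × v ∈ bag t
  edge-in-bag uv∈ with triangle-edge {n} {es} uv∈
  ... | old ac∈es = let a∈j , c∈j = lookup-index (covers-edges D ac∈es) in
    combine (index (covers-edges D ac∈es)) zero , old∈bag zero a∈j , old∈bag zero c∈j
  ... | attached₁ e = combine (home e) (suc e) , old∈bag (suc e) (proj₁ (home-contains-ends e)) , new∈home e
  ... | attached₂ e = combine (home e) (suc e) , old∈bag (suc e) (proj₂ (home-contains-ends e)) , new∈home e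

  vertex-in-bag : ∀ w → ∃ λ t → w ∈ bag t
  vertex-in-bag w with splitView n m w
  ... | left u  = combine (index (covers-vertices D u)) zero , old∈bag zero (lookup-index (covers-vertices D u))
  ... | right e = combine (home e) (suc e) , new∈home e

  bag-interval : ∀ w {i j k} → i Fin.≤ j → j Fin.≤ k → w ∈ bag i → w ∈ bag k → w ∈ bag j
  bag-interval w {i} {j} {k} i≤j j≤k w∈i w∈k with splitView n m w
  ... | left u = ∈-++⁺ˡ (B (block j)) (extra (block j) (copy j))
                   (interpolation D u (block i) (block j) (block k) (block-mono i≤j) (block-mono j≤k)
                     (old∈bag⇒ i w∈i) (old∈bag⇒ k w∈k))
  ... | right e = subst (λ t → n ↑ʳ e ∈ bag t) i≡j w∈i
    where
    i≡k : i ≡ k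
    i≡k = trans (new∈bag⇒home i w∈i) (sym (new∈bag⇒home k w∈k))
    i≡j : i ≡ j
    i≡j = ≤-antisym i≤j (subst (j Fin.≤_) (sym i≡k) j≤k)

  indexed : IndexedPathDecomposition (triangle (mkGraph n es)) (L * suc m)
  indexed = record { bag = bag ; vertex-in-bag = vertex-in-bag ; edge-in-bag = edge-in-bag ; bag-interval = bag-interval }

  ∣bag∣≤ : ∀ {w} → WidthAtMost D w → ∀ t → ∣ bag t ∣ ≤ suc (suc w)
  ∣bag∣≤ {w} width t = begin
    ∣ B (block t) Vec.++ extra (block t) (copy t) ∣  ≡⟨ ∣p++q∣≡∣p∣+∣q∣ (B (block t)) (extra (block t) (copy t)) ⟩
    ∣ B (block t) ∣ + ∣ extra (block t) (copy t) ∣    ≤⟨ +-mono-≤ (All.lookup width (∈-lookup (block t))) (∣extra∣≤1 (block t) (copy t)) ⟩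
    suc w + 1                                          ≡⟨ +-comm (suc w) 1 ⟩
    suc (suc w)                                        ∎
    where open ≤-Reasoning

pw-triangle≤ : ∀ G {w} → PwAtMost G w → PwAtMost (triangle G) (suc w)
pw-triangle≤ (mkGraph n es) (D , width) =
  toPathDecomposition indexed , toPathDecomposition-width indexed (∣bag∣≤ width)
  where open TriangleDecomposition D

proposition30 : ∀ (G : Graph) → Simple G → ∀ (p q : ℕ) →
    IsPathwidth G p → IsPathwidth (triangle G) q → q ≤ suc p
proposition30 G _ p q (pwG≤p , _) (_ , minimal) with q ≤? suc p
... | yes q≤1+p = q≤1+p
... | no q≰1+p  = contradiction (pw-triangle≤ G pwG≤p) (minimal (suc p) (≰⇒> q≰1+p))
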